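{- Let $b\ge 2$ be a base and, for $n\ge 1$, let $R_n=\frac{b^n-1}{b-1}=[(1)^{\land n}]_b$. If $n$ is not divisible by $b-1$, then $(b-1)nR_n$ is a $b$-Niven number that is not a $b$-MRH number.
   Context: $[(1)^{\land n}]_b$ denotes the integer whose base-$b$ representation consists of $n$ ones. For a positive integer $N$, $s_b(N)$ is the sum of the base-$b$ digits of $N$, and the reversal $N^R$ is the integer obtained by writing the base-$b$ digits of $N$ in reverse order. A positive integer $N$ is a $b$-Niven number if $s_b(N)$ divides $N$. A positive integer $N$ is a $b$-MRH number if there exists a positive integer $M$ such that $N=Ms_b(N)\cdot(Ms_b(N))^R$. -}

module Defs where

open import Data.Nat using (ℕ; zero; suc; _+_; _*_; _∸_; _^_; _<_)
open import Data.Nat.DivMod using (_/_; _%_)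
open import Data.Nat.Divisibility using (_∣_)
open import Data.List using (List; []; _∷_; foldr; reverse)
open import Data.Nat.ListAction using (sum)
open import Data.Product using (∃; _×_)
open import Relation.Binary.PropositionalEquality using (_≡_)

-- base-b digits of n, least significant first, with fuel (fuel n suffices).
-- Only meaningful for b ≥ 2; for b = 0 it returns [] (never used).
digitsFuel : ℕ → ℕ → ℕ → List ℕ
digitsFuel zero    b       n       = []
digitsFuel (suc f) zero    n       = []
digitsFuel (suc f) (suc c) zero    = []
digitsFuel (suc f) (suc c) (suc m) = (suc m % suc c) ∷ digitsFuel f (suc c) (suc m / suc c)

digits : ℕ → ℕ → List ℕ
digits b n = digitsFuel n b n

fromDigits : ℕ → List ℕ → ℕ
fromDigits b = foldr (λ d acc → d + b * acc) 0

digitSum : ℕ → ℕ → ℕ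
digitSum b n = sum (digits b n)

reversal : ℕ → ℕ → ℕ
reversal b n = fromDigits b (reverse (digits b n))

repunit : ℕ → ℕ → ℕ
repunit b zero    = 0
repunit b (suc n) = 1 + b * repunit b n

IsNiven : ℕ → ℕ → Set
IsNiven b N = 0 < N × digitSum b N ∣ N

IsMRH : ℕ → ℕ → Set
IsMRH b N = 0 < N × ∃ λ M → 0 < M × N ≡ (M * digitSum b N) * reversal b (M * digitSum b N)

module Submission where

-- Write d = b − 1, Rₙ = [(1)^n]_b and N = d·n·Rₙ = n·(bⁿ − 1) for n ≥ 1.
--
-- Splitting N = (n − 1)·bⁿ + (bⁿ − n) shows that the base-b
-- representation of N is that of n − 1 followed by the n-digit block of bⁿ − n.
-- Since (n − 1) + (bⁿ − n) = bⁿ − 1 = [(d)^n]_b, the two blocks are digitwise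
-- complementary (every digit pair sums to d, no carries), so s_b(N) = n·d.
-- Hence N = Rₙ · s_b(N), so N is b-Niven.
--
-- A number and its digit sum, and likewise a number and its digit
-- reversal, are congruent modulo d (because b ≡ 1).  If N = y·y^R with
-- y = M·s_b(N), cancelling s_b(N) = n·d gives Rₙ = M·y^R; since d ∣ y we get
-- d ∣ y^R ∣ Rₙ, and Rₙ ≡ n (mod d) then yields d ∣ n, contrary to hypothesis.

open import Defs
open import Data.Nat using (ℕ; _*_; _∸_; _≤_)
open import Data.Nat.Divisibility using (_∣_)
open import Data.Product using (_×_)
open import Relation.Nullary using (¬_)

open import Data.Nat using (zero; suc; _+_; _^_; _<_; z≤n; s≤s)
open import Data.Nat.Properties
open import Data.Nat.DivMod
open import Data.Nat.Divisibility
  using (divides; ∣m+n∣m⇒∣n; n∣m*n; ∣n⇒∣m*n; m%n≡0⇒n∣m; n∣m⇒m%n≡0)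
open import Data.Nat.ListAction using (sum)
open import Data.Nat.ListAction.Properties using (sum-↭)
open import Data.Nat.Tactic.RingSolver using (solve-∀)
open import Data.List using (List; []; _∷_; reverse; replicate)
open import Data.List.Relation.Binary.Permutation.Propositional.Properties using (↭-reverse)
open import Data.Product using (_,_; proj₁; proj₂)
open import Data.Empty using (⊥-elim)
open import Relation.Binary.PropositionalEquality

sum-reverse : ∀ (L : List ℕ) → sum (reverse L) ≡ sum L
sum-reverse L = sum-↭ (↭-reverse L)

sum-replicate : ∀ n x → sum (replicate n x) ≡ n * x
sum-replicate zero    x = refl
sum-replicate (suc n) x = cong (x +_) (sum-replicate n x)

module Base (c : ℕ) where

  d : ℕ
  d = suc c

  b : ℕ
  b = suc d

  1<b : 1 < b
  1<b = s≤s (s≤s z≤n)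

  digitsFuel-zero : ∀ f → digitsFuel f b 0 ≡ []
  digitsFuel-zero zero    = refl
  digitsFuel-zero (suc f) = refl

  quotient-≤ : ∀ m → suc m / b ≤ m
  quotient-≤ m = ≤-pred (m/n<m (suc m) b 1<b)

  digitsFuel-enough : ∀ f g x → x ≤ f → x ≤ g → digitsFuel f b x ≡ digitsFuel g b x
  digitsFuel-enough f g zero _ _ = trans (digitsFuel-zero f) (sym (digitsFuel-zero g))
  digitsFuel-enough (suc f) (suc g) (suc m) (s≤s x≤f) (s≤s x≤g) =
    cong (suc m % b ∷_)
      (digitsFuel-enough f g (suc m / b)
        (≤-trans (quotient-≤ m) x≤f) (≤-trans (quotient-≤ m) x≤g))

  digits-suc : ∀ m → digits b (suc m) ≡ (suc m % b) ∷ digits b (suc m / b)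
  digits-suc m =
    cong (suc m % b ∷_) (digitsFuel-enough m (suc m / b) (suc m / b) (quotient-≤ m) ≤-refl)

  digitSum-step : ∀ x → digitSum b x ≡ x % b + digitSum b (x / b)
  digitSum-step zero    = refl
  digitSum-step (suc m) = cong sum (digits-suc m)

  fromDigits-digits-≤ : ∀ f x → x ≤ f → fromDigits b (digits b x) ≡ x
  fromDigits-digits-≤ _ zero _ = refl
  fromDigits-digits-≤ (suc f) (suc m) (s≤s x≤f) = begin
      fromDigits b (digits b (suc m))             ≡⟨ cong (fromDigits b) (digits-suc m) ⟩
      suc m % b + b * fromDigits b (digits b q)   ≡⟨ cong (λ t → suc m % b + b * t) ih ⟩
      suc m % b + b * q                           ≡⟨ cong (suc m % b +_) (*-comm b q) ⟩
      suc m % b + q * b                           ≡⟨ m≡m%n+[m/n]*n (suc m) b ⟨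
      suc m                                       ∎
    where
      open ≡-Reasoning
      q = suc m / b
      ih = fromDigits-digits-≤ f q (≤-trans (quotient-≤ m) x≤f)

  fromDigits-digits : ∀ x → fromDigits b (digits b x) ≡ x
  fromDigits-digits x = fromDigits-digits-≤ x x ≤-refl

  digitSum-cons : ∀ r q → r < b → digitSum b (r + q * b) ≡ r + digitSum b q
  digitSum-cons r q r<b = begin
      digitSum b (r + q * b)                       ≡⟨ digitSum-step (r + q * b) ⟩
      (r + q * b) % b + digitSum b ((r + q * b) / b)
        ≡⟨ cong₂ (λ u v → u + digitSum b v) last-digit quotient ⟩
      r + digitSum b q                             ∎
    where
      open ≡-Reasoning
      last-digit : (r + q * b) % b ≡ r
      last-digit = trans ([m+kn]%n≡m%n r q b) (m<n⇒m%n≡m r<b)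
      no-carry : r % b + (q * b) % b < b
      no-carry = subst (_< b) (sym (cong₂ _+_ (m<n⇒m%n≡m r<b) (m*n%n≡0 q b)))
                   (subst (_< b) (sym (+-identityʳ r)) r<b)
      quotient : (r + q * b) / b ≡ q
      quotient = trans (+-distrib-/ r (q * b) no-carry)
                   (cong₂ _+_ (m<n⇒m/n≡0 r<b) (m*n/n≡m q b))

  -- Concatenation: if x has at most k digits, the digits of x + bᵏ·y are those
  -- of y followed by those of x (padded to length k), so digit sums add.
  digitSum-concat : ∀ k x y → x < b ^ k →
    digitSum b (x + b ^ k * y) ≡ digitSum b x + digitSum b y
  digitSum-concat zero zero y _ = cong (digitSum b) (+-identityʳ y)
  digitSum-concat zero (suc x) y (s≤s ())
  digitSum-concat (suc k) x y x<bᵏ⁺¹ = begin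
      digitSum b (x + b ^ suc k * y)
        ≡⟨ cong (λ t → digitSum b (t + b ^ suc k * y)) (m≡m%n+[m/n]*n x b) ⟩
      digitSum b (r + q * b + b * b ^ k * y)       ≡⟨ cong (digitSum b) (regroup r q (b ^ k) y c) ⟩
      digitSum b (r + (q + b ^ k * y) * b)        ≡⟨ digitSum-cons r (q + b ^ k * y) (m%n<n x b) ⟩
      r + digitSum b (q + b ^ k * y)              ≡⟨ cong (r +_) (digitSum-concat k q y q<bᵏ) ⟩
      r + (digitSum b q + digitSum b y)           ≡⟨ +-assoc r _ _ ⟨
      r + digitSum b q + digitSum b y             ≡⟨ cong (_+ digitSum b y) (digitSum-step x) ⟨
      digitSum b x + digitSum b y                 ∎
    where
      open ≡-Reasoning
      r = x % b
      q = x / b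
      q<bᵏ : q < b ^ k
      q<bᵏ = m<n*o⇒m/o<n (subst (x <_) (*-comm b (b ^ k)) x<bᵏ⁺¹)
      regroup : ∀ r q P y c →
        r + q * suc (suc c) + suc (suc c) * P * y ≡ r + (q + P * y) * suc (suc c)
      regroup = solve-∀

  carry-is-b : ∀ t → suc t < b + b → b ∣ suc t → suc t ≡ b
  carry-is-b t _ (divides zero ())
  carry-is-b t _ (divides (suc zero) eq) = trans eq (+-identityʳ b)
  carry-is-b t t<2b (divides (suc (suc j)) eq) =
    ⊥-elim (<⇒≱ t<2b (subst (b + b ≤_) (sym eq) (+-monoʳ-≤ b (m≤m+n b (j * b)))))

  complement-split : ∀ k m m' → suc (m + m') ≡ b ^ suc k →
    m % b + m' % b ≡ d × suc (m / b + m' / b) ≡ b ^ k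
  complement-split k m m' total = suc-injective last , *-cancelʳ-≡ _ _ b rest
    where
      r = m % b
      r' = m' % b
      q = m / b
      q' = m' / b
      regroup : ∀ r q r' q' c → suc (r + q * suc (suc c) + (r' + q' * suc (suc c)))
                  ≡ (q + q') * suc (suc c) + suc (r + r')
      regroup = solve-∀
      expanded : (q + q') * b + suc (r + r') ≡ b ^ k * b
      expanded = begin
          (q + q') * b + suc (r + r')    ≡⟨ regroup r q r' q' c ⟨
          suc (r + q * b + (r' + q' * b))
            ≡⟨ cong₂ (λ u v → suc (u + v)) (m≡m%n+[m/n]*n m b) (m≡m%n+[m/n]*n m' b) ⟨
          suc (m + m')                   ≡⟨ total ⟩
          b * b ^ k                      ≡⟨ *-comm b (b ^ k) ⟩
          b ^ k * b                      ∎
        where open ≡-Reasoning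
      b∣carry : b ∣ suc (r + r')
      b∣carry = ∣m+n∣m⇒∣n (subst (b ∣_) (sym expanded) (n∣m*n (b ^ k))) (n∣m*n (q + q'))
      last : suc (r + r') ≡ b
      last = carry-is-b (r + r') (+-mono-≤-< (m%n<n m b) (m%n<n m' b)) b∣carry
      rest : suc (q + q') * b ≡ b ^ k * b
      rest = trans (+-comm b ((q + q') * b))
               (trans (cong ((q + q') * b +_) (sym last)) expanded)

  -- Complementary numbers: if m + m' = bᵏ − 1 then every digit pair sums to d,
  -- so s_b(m) + s_b(m') = k·d.
  digitSum-complement : ∀ k m m' → suc (m + m') ≡ b ^ k →
    digitSum b m + digitSum b m' ≡ k * d
  digitSum-complement zero zero zero _ = refl
  digitSum-complement (suc k) m m' total = begin
      digitSum b m + digitSum b m'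
        ≡⟨ cong₂ _+_ (digitSum-step m) (digitSum-step m') ⟩
      (m % b + digitSum b q) + (m' % b + digitSum b q')
        ≡⟨ interchange (m % b) (digitSum b q) (m' % b) (digitSum b q') ⟩
      (m % b + m' % b) + (digitSum b q + digitSum b q')
        ≡⟨ cong₂ _+_ last (digitSum-complement k q q' rest) ⟩
      d + k * d                                     ∎
    where
      open ≡-Reasoning
      q = m / b
      q' = m' / b
      last = proj₁ (complement-split k m m' total)
      rest = proj₂ (complement-split k m m' total)
      interchange : ∀ a x a' x' → (a + x) + (a' + x') ≡ (a + a') + (x + x')
      interchange = solve-∀

  -- Since b ≡ 1 (mod d), the value of a digit list is congruent to its digit sum.
  fromDigits-mod : ∀ L → fromDigits b L % d ≡ sum L % d
  fromDigits-mod [] = refl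
  fromDigits-mod (x ∷ L) = begin
      (x + b * F) % d                  ≡⟨ cong (_% d) (b≡1 x F c) ⟩
      ((x + F) + F * d) % d            ≡⟨ [m+kn]%n≡m%n (x + F) F d ⟩
      (x + F) % d                      ≡⟨ %-distribˡ-+ x F d ⟩
      (x % d + F % d) % d              ≡⟨ cong (λ t → (x % d + t) % d) (fromDigits-mod L) ⟩
      (x % d + sum L % d) % d          ≡⟨ %-distribˡ-+ x (sum L) d ⟨
      (x + sum L) % d                  ∎
    where
      open ≡-Reasoning
      F = fromDigits b L
      b≡1 : ∀ x F c → x + suc (suc c) * F ≡ (x + F) + F * suc c
      b≡1 = solve-∀

  digitSum-mod : ∀ x → digitSum b x % d ≡ x % d
  digitSum-mod x = trans (sym (fromDigits-mod (digits b x))) (cong (_% d) (fromDigits-digits x))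

  reversal-mod : ∀ y → reversal b y % d ≡ y % d
  reversal-mod y = begin
      fromDigits b (reverse (digits b y)) % d  ≡⟨ fromDigits-mod (reverse (digits b y)) ⟩
      sum (reverse (digits b y)) % d           ≡⟨ cong (_% d) (sum-reverse (digits b y)) ⟩
      digitSum b y % d                         ≡⟨ digitSum-mod y ⟩
      y % d                                    ∎
    where open ≡-Reasoning

  -- Rₙ is the value of the digit list of n ones, hence Rₙ ≡ n (mod d).
  repunit-digits : ∀ n → repunit b n ≡ fromDigits b (replicate n 1)
  repunit-digits zero    = refl
  repunit-digits (suc n) = cong (λ t → 1 + b * t) (repunit-digits n)

  repunit-mod : ∀ n → repunit b n % d ≡ n % d
  repunit-mod n = begin
      repunit b n % d                   ≡⟨ cong (_% d) (repunit-digits n) ⟩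
      fromDigits b (replicate n 1) % d  ≡⟨ fromDigits-mod (replicate n 1) ⟩
      sum (replicate n 1) % d           ≡⟨ cong (_% d) (trans (sum-replicate n 1) (*-identityʳ n)) ⟩
      n % d                             ∎
    where open ≡-Reasoning

  repunit-scaled : ∀ n → suc (d * repunit b n) ≡ b ^ n
  repunit-scaled zero    = cong suc (*-zeroʳ d)
  repunit-scaled (suc n) = trans (unfold (repunit b n) c) (cong (b *_) (repunit-scaled n))
    where
      unfold : ∀ R c → suc (suc c * (1 + suc (suc c) * R)) ≡ suc (suc c) * suc (suc c * R)
      unfold = solve-∀

  repunit-≥ : ∀ n → n ≤ repunit b n
  repunit-≥ zero    = z≤n
  repunit-≥ (suc n) = s≤s (≤-trans (repunit-≥ n) (m≤n*m (repunit b n) b))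

  ∣-resp-mod : ∀ {x y} → x % d ≡ y % d → d ∣ x → d ∣ y
  ∣-resp-mod {x} {y} x≡y d∣x = m%n≡0⇒n∣m y d (trans (sym x≡y) (n∣m⇒m%n≡0 x d d∣x))

  -- The number of the theorem, for n = m + 1.
  N : ℕ → ℕ
  N m = d * suc m * repunit b (suc m)

  N-factor : ∀ m → N m ≡ repunit b (suc m) * (suc m * d)
  N-factor m = rearrange c (suc m) (repunit b (suc m))
    where
      rearrange : ∀ c n R → suc c * n * R ≡ R * (n * suc c)
      rearrange = solve-∀

  -- With n = m + 1 and n + o = d·Rₙ = bⁿ − 1, we have N = (o + 1) + bⁿ·m where
  -- o + 1 = bⁿ − n < bⁿ and m + (o + 1) = bⁿ − 1; so s_b(N) = n·d.
  digitSum-N : ∀ m → digitSum b (N m) ≡ suc m * d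
  digitSum-N m with m≤n⇒∃[o]m+o≡n (≤-trans (repunit-≥ (suc m)) (m≤n*m (repunit b (suc m)) d))
  ... | o , n+o≡dR = begin
      digitSum b (N m)                   ≡⟨ cong (digitSum b) split ⟩
      digitSum b (suc o + b ^ n * m)     ≡⟨ digitSum-concat n (suc o) m low<bⁿ ⟩
      digitSum b (suc o) + digitSum b m  ≡⟨ +-comm (digitSum b (suc o)) _ ⟩
      digitSum b m + digitSum b (suc o)  ≡⟨ digitSum-complement n m (suc o) complementary ⟩
      n * d                              ∎
    where
      open ≡-Reasoning
      n = suc m
      bⁿ : suc (n + o) ≡ b ^ n
      bⁿ = trans (cong suc n+o≡dR) (repunit-scaled n)
      expand : ∀ c m o R → suc m + o ≡ suc c * R →
        suc c * suc m * R ≡ suc o + suc (suc m + o) * m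
      expand c m o R eq = trans (regroup c (suc m) R) (trans (cong (suc m *_) (sym eq)) (square m o))
        where
          regroup : ∀ c n R → suc c * n * R ≡ n * (suc c * R)
          regroup = solve-∀
          square : ∀ m o → suc m * (suc m + o) ≡ suc o + suc (suc m + o) * m
          square = solve-∀
      split : N m ≡ suc o + b ^ n * m
      split = trans (expand c m o _ n+o≡dR) (cong (λ t → suc o + t * m) bⁿ)
      low<bⁿ : suc o < b ^ n
      low<bⁿ = subst (suc o <_) bⁿ (s≤s (s≤s (m≤n+m o m)))
      complementary : suc (m + suc o) ≡ b ^ n
      complementary = trans (cong suc (+-suc m o)) bⁿ

  N-niven : ∀ m → IsNiven b (N m)
  N-niven m = s≤s z≤n , divides R (trans (N-factor m) (cong (R *_) (sym (digitSum-N m))))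
    where R = repunit b (suc m)

  -- An MRH representation N = y·y^R, y = M·s_b(N), forces Rₙ = M·y^R; as d ∣ y,
  -- also d ∣ y^R ∣ Rₙ, and Rₙ ≡ n (mod d) gives d ∣ n.
  N-not-MRH : ∀ m → ¬ d ∣ suc m → ¬ IsMRH b (N m)
  N-not-MRH m d∤n (_ , M , _ , mrh) = d∤n (∣-resp-mod (repunit-mod (suc m)) d∣R)
    where
      R = repunit b (suc m)
      s = suc m * d
      y = M * s
      v = reversal b y
      representation : R * s ≡ M * v * s
      representation = begin
          R * s          ≡⟨ N-factor m ⟨
          N m            ≡⟨ subst (λ t → N m ≡ M * t * reversal b (M * t)) (digitSum-N m) mrh ⟩
          M * s * v      ≡⟨ swap M s v ⟩
          M * v * s      ∎
        where
          open ≡-Reasoning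
          swap : ∀ M s v → M * s * v ≡ M * v * s
          swap = solve-∀
      d∣y : d ∣ y
      d∣y = ∣n⇒∣m*n M (n∣m*n (suc m))
      d∣v : d ∣ v
      d∣v = ∣-resp-mod (sym (reversal-mod y)) d∣y
      d∣R : d ∣ R
      d∣R = subst (d ∣_) (sym (*-cancelʳ-≡ R (M * v) s representation)) (∣n⇒∣m*n M d∣v)

theorem25 : (b n : ℕ) → 2 ≤ b → 1 ≤ n → ¬ ((b ∸ 1) ∣ n) →
    IsNiven b ((b ∸ 1) * n * repunit b n) × ¬ IsMRH b ((b ∸ 1) * n * repunit b n)
theorem25 (suc (suc c)) (suc m) (s≤s (s≤s z≤n)) (s≤s z≤n) d∤n = Base.N-niven c m , Base.N-not-MRH c m d∤n
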